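{- Let $\mathcal{A}_1 = \langle Q_1, \iota_1, \Sigma, \delta_1, \alpha_1\rangle$ be an alternating Büchi automaton and let ${\sf MH}(\mathcal{A}_1)$ be its Miyano–Hayashi automaton. Then the partial order $\preceq_{\sf alt}$ is a simulation for ${\sf MH}(\mathcal{A}_1)$.
   Context: An alternating Büchi automaton (ABW) is a tuple $\mathcal{A}_1 = \langle Q_1, \iota_1, \Sigma, \delta_1, \alpha_1\rangle$ with finite state set $Q_1$, initial state $\iota_1$, finite alphabet $\Sigma$, accepting set $\alpha_1\subseteq Q_1$, and transition function $\delta_1: Q_1\times\Sigma\to\mathcal{B}^+(Q_1)$, where $\mathcal{B}^+(Q_1)$ is the set of positive Boolean formulas built from elements of $Q_1\cup\{\mathsf{true},\mathsf{false}\}$ with $\wedge,\vee$. A set $X\subseteq Q_1$ satisfies $\varphi\in\mathcal{B}^+(Q_1)$ (written $X\models\varphi$) if the assignment making exactly the members of $X$ true satisfies $\varphi$. The Miyano–Hayashi automaton ${\sf MH}(\mathcal{A}_1)$ is the nondeterministic Büchi automaton with states $2^{Q_1}\times 2^{Q_1}$, initial state $(\{\iota_1\},\emptyset)$, alphabet $\Sigma$, accepting set $2^{Q_1}\times\{\emptyset\}$, and transition function $\delta'$ given for $\langle s,o\rangle$ and $\sigma$ by: if $o\neq\emptyset$, $\delta'(\langle s,o\rangle,\sigma)=\{\langle s', o'\setminus\alpha_1\rangle \mid o'\subseteq s',\ s'\models\bigwedge_{\ell\in s}\delta_1(\ell,\sigma),\ o'\models\bigwedge_{\ell\in o}\delta_1(\ell,\sigma)\}$;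 if $o=\emptyset$, $\delta'(\langle s,o\rangle,\sigma)=\{\langle s', s'\setminus\alpha_1\rangle \mid s'\models\bigwedge_{\ell\in s}\delta_1(\ell,\sigma)\}$. The order $\preceq_{\sf alt}$ on $2^{Q_1}\times 2^{Q_1}$ is: $\langle s,o\rangle\preceq_{\sf alt}\langle s',o'\rangle$ iff $s\subseteq s'$, $o\subseteq o'$, and ($o=\emptyset$ iff $o'=\emptyset$). For an NBW $\langle Q,\iota,\Sigma,\delta,\alpha\rangle$ (with $\delta:Q\times\Sigma\to 2^Q$), a pre-order $\preceq$ on $Q$ is a simulation if (1) whenever $\ell_3\preceq\ell_1$ and $\ell_2\in\delta(\ell_1,\sigma)$, there is $\ell_4\preceq\ell_2$ with $\ell_4\in\delta(\ell_3,\sigma)$; and (2) for all $\ell\in\alpha$, every $\ell'\preceq\ell$ lies in $\alpha$. -}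

module Defs where

open import Level using (0ℓ)
open import Data.Nat using (ℕ)
open import Data.Fin using (Fin)
open import Data.Fin.Subset using (Subset; _∈_; _∉_; _⊆_; _─_; ⊥; ⁅_⁆)
open import Data.Product using (_×_; _,_; ∃; Σ)
open import Data.Sum using (_⊎_)
open import Data.Unit using (⊤)
open import Data.Empty renaming (⊥ to Empty)
open import Relation.Binary.PropositionalEquality using (_≡_)
open import Relation.Binary.Structures using (IsPreorder)
open import Relation.Nullary using (¬_)

data PBF (Q : Set) : Set where
  atom : Q → PBF Q
  tt   : PBF Q
  ff   : PBF Q
  _∧_  : PBF Q → PBF Q → PBF Q
  _∨_  : PBF Q → PBF Q → PBF Q

_⊨_ : ∀ {n} → Subset n → PBF (Fin n) → Set
X ⊨ atom q = q ∈ X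
X ⊨ tt = ⊤
X ⊨ ff = Empty
X ⊨ (φ ∧ ψ) = (X ⊨ φ) × (X ⊨ ψ)
X ⊨ (φ ∨ ψ) = (X ⊨ φ) ⊎ (X ⊨ ψ)

_⊨⋀_ : ∀ {n} → Subset n → (Fin n → PBF (Fin n)) → Subset n → Set
_⊨⋀_ {n} X f s = ∀ (ℓ : Fin n) → ℓ ∈ s → X ⊨ f ℓ

record ABW (n k : ℕ) : Set where
  field
    ι : Fin n
    δ : Fin n → Fin k → PBF (Fin n)
    α : Subset n

-- Nondeterministic Büchi automaton with state type S and alphabet Fin k;
-- the transition function δ : S × Σ → 2^S is given by its membership
-- relation (δ s σ s' means s' ∈ δ(s, σ)), and α by a predicate.
record NBW (S : Set) (k : ℕ) : Set₁ where
  field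
    ι : S
    δ : S → Fin k → S → Set
    α : S → Set

record IsSimulation {S : Set} {k : ℕ} (A : NBW S k) (_≼_ : S → S → Set) : Set₁ where
  open NBW A
  field
    isPreorder : IsPreorder _≡_ _≼_
    step : ∀ ℓ₁ ℓ₂ ℓ₃ σ → ℓ₃ ≼ ℓ₁ → δ ℓ₁ σ ℓ₂ → ∃ λ ℓ₄ → (ℓ₄ ≼ ℓ₂) × δ ℓ₃ σ ℓ₄
    acc  : ∀ ℓ ℓ′ → α ℓ → ℓ′ ≼ ℓ → α ℓ′

Empty? : ∀ {n} → Subset n → Set
Empty? o = o ≡ ⊥

MHState : ℕ → Set
MHState n = Subset n × Subset n

MHδ : ∀ {n k} → ABW n k → MHState n → Fin k → MHState n → Set
MHδ A (s , o) σ (s″ , o″) =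
    (¬ Empty? o × ∃ λ s′ → ∃ λ o′ →
        (o′ ⊆ s′) × (s′ ⊨⋀ (λ ℓ → ABW.δ A ℓ σ)) s × (o′ ⊨⋀ (λ ℓ → ABW.δ A ℓ σ)) o
        × (s″ ≡ s′) × (o″ ≡ o′ ─ ABW.α A))
  ⊎ (Empty? o × ∃ λ s′ →
        (s′ ⊨⋀ (λ ℓ → ABW.δ A ℓ σ)) s × (s″ ≡ s′) × (o″ ≡ s′ ─ ABW.α A))

MH : ∀ {n k} → ABW n k → NBW (MHState n) k
MH {n} A = record
  { ι = (⁅ ABW.ι A ⁆ , ⊥)
  ; δ = MHδ A
  ; α = λ q → Empty? (Data.Product.proj₂ q)
  }

_≼alt_ : ∀ {n} → MHState n → MHState n → Set
(s , o) ≼alt (s′ , o′) = (s ⊆ s′) × (o ⊆ o′) × ((Empty? o → Empty? o′) × (Empty? o′ → Empty? o))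

module Submission where

-- Idea: a transition of MH(A) from ⟨s,o⟩ only imposes constraints, namely
-- that the successor sets satisfy ⋀_{ℓ∈s} δ(ℓ,σ) and ⋀_{ℓ∈o} δ(ℓ,σ), and
-- which of the two transition rules applies depends only on whether o = ∅.
-- A conjunction over a smaller set of states is weaker, and ≼alt preserves
-- emptiness of the second component, so every transition of a larger state
-- is also a transition of any smaller state.  Hence the simulation game is
-- won by answering every move ℓ₁ →σ ℓ₂ with the very same successor ℓ₂.

open import Defs
open import Data.Nat using (ℕ)
open import Data.Fin using (Fin)
open import Data.Fin.Subset using (Subset; _⊆_)
open import Data.Product using (_×_; _,_; proj₂)
open import Data.Sum using (inj₁; inj₂)
open import Relation.Binary.PropositionalEquality using (_≡_; refl; isEquivalence)
open import Relation.Binary.Structures using (IsPreorder)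

≼alt-refl : ∀ {n} (x : MHState n) → x ≼alt x
≼alt-refl (s , o) = (λ p → p) , (λ p → p) , (λ e → e) , (λ e → e)

≼alt-trans : ∀ {n} {x y z : MHState n} → x ≼alt y → y ≼alt z → x ≼alt z
≼alt-trans {x = _ , _} {_ , _} {_ , _}
           (s⊆s′ , o⊆o′ , ∅⇒∅′ , ∅′⇒∅) (s′⊆s″ , o′⊆o″ , ∅′⇒∅″ , ∅″⇒∅′) =
  (λ p → s′⊆s″ (s⊆s′ p)) , (λ p → o′⊆o″ (o⊆o′ p)) ,
  (λ e → ∅′⇒∅″ (∅⇒∅′ e)) , (λ e → ∅′⇒∅ (∅″⇒∅′ e))

≼alt-isPreorder : ∀ {n} → IsPreorder {A = MHState n} _≡_ _≼alt_
≼alt-isPreorder = record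
  { isEquivalence = isEquivalence
  ; reflexive     = λ { {x} refl → ≼alt-refl x }
  ; trans         = ≼alt-trans
  }

⊨⋀-antitone : ∀ {n} {X : Subset n} {f : Fin n → PBF (Fin n)} {s t : Subset n} →
              s ⊆ t → (X ⊨⋀ f) t → (X ⊨⋀ f) s
⊨⋀-antitone s⊆t X⊨t ℓ ℓ∈s = X⊨t ℓ (s⊆t ℓ∈s)

-- Shrinking the source state w.r.t. ≼alt keeps every transition: the same
-- rule applies (emptiness of o is preserved) with weaker conjunctions.
MHδ-antitone : ∀ {n k} (A : ABW n k) {x y : MHState n} σ {z : MHState n} →
               y ≼alt x → MHδ A x σ z → MHδ A y σ z
MHδ-antitone A {_ , _} {_ , _} σ (s⊆ , o⊆ , ∅⇒∅ , _)
             (inj₁ (o≠∅ , s′ , o′ , o′⊆s′ , s′⊨ , o′⊨ , eqs , eqo)) =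
  inj₁ ((λ e → o≠∅ (∅⇒∅ e)) , s′ , o′ , o′⊆s′ ,
        ⊨⋀-antitone s⊆ s′⊨ , ⊨⋀-antitone o⊆ o′⊨ , eqs , eqo)
MHδ-antitone A {_ , _} {_ , _} σ (s⊆ , _ , _ , ∅′⇒∅)
             (inj₂ (o=∅ , s′ , s′⊨ , eqs , eqo)) =
  inj₂ (∅′⇒∅ o=∅ , s′ , ⊨⋀-antitone s⊆ s′⊨ , eqs , eqo)

accepting-downward : ∀ {n} (x y : MHState n) →
                     Empty? (proj₂ x) → y ≼alt x → Empty? (proj₂ y)
accepting-downward (_ , _) (_ , _) o=∅ (_ , _ , _ , ∅′⇒∅) = ∅′⇒∅ o=∅

lemma4p2 : ∀ {n k : ℕ} (A : ABW n k) → IsSimulation (MH A) _≼alt_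
lemma4p2 A = record
  { isPreorder = ≼alt-isPreorder
  ; step       = λ ℓ₁ ℓ₂ ℓ₃ σ ℓ₃≼ℓ₁ ℓ₁→ℓ₂ →
                   ℓ₂ , ≼alt-refl ℓ₂ , MHδ-antitone A σ ℓ₃≼ℓ₁ ℓ₁→ℓ₂
  ; acc        = accepting-downward
  }
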